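{- Let $G$ be an st-graph having $n$ vertices and a (transitive) congruence partition $C_P$. If $w_N$ is the dimensional neck of $G(C_P)$, then $d_G\le\min\left(\frac{n}{2},w_N\right)$.
   Context: An st-graph is a directed acyclic graph with exactly one source $s$ and exactly one sink $t$, $s\neq t$. Vertex $v$ is reachable from $u$ if there is a directed path (possibly of length zero). The width of a DAG is the maximum size of a set of pairwise incomparable vertices. Let $G^*$ be the transitive closure of $G$. A transitive module is a nonempty $M\subseteq V$ whose vertices all have the same predecessors and the same successors in $V\setminus M$ in $G^*$. A congruence partition $C_P=\{M_1,\dots,M_h\}$ is a partition of $V$ into transitive modules. The quotient graph $G_0$ is obtained from $G$ by merging the vertices of each $M_i$ into one vertex $\mu_i$. For $1\le i\le h$, the module-induced graph $G_i$ is the subgraph induced by $M_i$, augmented when necessary with a virtual source (edges to all of $M_i$) and/or virtual sink (edges from all of $M_i$) so that it is an st-graph. $G(C_P)=\{G_0,\dots,G_h\}$, and its dimensional neck $w_N$ is the maximum width of a graph in $G(C_P)$. A $d$-dimensional dominance drawing assigns each vertex $v$ a point $(D_1(v),\dots,D_d(v))$ with $v$ reachable from $u$ iff $D_g(u)\le D_g(v)$ for all $g$; the dominance dimension $d_G$ is the least such $d$. -}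

module Defs where

open import Data.Nat using (ℕ; _≤_)
open import Data.Fin using (Fin)
open import Data.Bool using (Bool; T)
open import Data.Unit using (⊤)
open import Data.Empty using (⊥)
open import Data.Sum using (_⊎_; inj₁; inj₂)
open import Data.Product using (Σ; Σ-syntax; ∃; _×_; _,_; proj₁)
open import Data.List using (List; length)
open import Data.List.Membership.Propositional using (_∈_)
open import Data.List.Relation.Unary.Unique.Propositional using (Unique)
open import Relation.Binary.PropositionalEquality using (_≡_; _≢_)
open import Relation.Nullary using (¬_)
open import Function.Bundles using (_⇔_)

record Graph : Set₁ where
  constructor graph
  field
    V : Set
    E : V → V → Set
open Graph public

data Reach (g : Graph) : V g → V g → Set where
  here  : ∀ {u} → Reach g u u
  step  : ∀ {u w v} → E g u w → Reach g w v → Reach g u v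

Reach⁺ : (g : Graph) → V g → V g → Set
Reach⁺ g u v = Σ[ w ∈ V g ] (E g u w × Reach g w v)

Acyclic : Graph → Set
Acyclic g = ∀ u v → E g u v → ¬ Reach g v u

IsSource : (g : Graph) → V g → Set
IsSource g s = ∀ u → ¬ E g u s

IsSink : (g : Graph) → V g → Set
IsSink g t = ∀ u → ¬ E g t u

IsSTGraph : Graph → Set
IsSTGraph g =
  Acyclic g ×
  Σ[ s ∈ V g ] Σ[ t ∈ V g ]
    ( IsSource g s × (∀ v → IsSource g v → v ≡ s)
    × IsSink g t × (∀ v → IsSink g v → v ≡ t)
    × s ≢ t)

Antichain : (g : Graph) → List (V g) → Set
Antichain g xs =
  Unique xs × (∀ {x y} → x ∈ xs → y ∈ xs → x ≢ y → ¬ Reach g x y)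

IsWidth : Graph → ℕ → Set
IsWidth g w =
  (Σ[ xs ∈ List (V g) ] (Antichain g xs × length xs ≡ w)) ×
  (∀ xs → Antichain g xs → length xs ≤ w)

finGraph : (n : ℕ) → (Fin n → Fin n → Set) → Graph
finGraph n E = graph (Fin n) E

IsTransitiveModule : (g : Graph) → (V g → Set) → Set
IsTransitiveModule g M =
  (Σ[ v ∈ V g ] M v) ×
  (∀ x y → M x → M y → ∀ z → ¬ M z →
     (Reach⁺ g z x ⇔ Reach⁺ g z y) × (Reach⁺ g x z ⇔ Reach⁺ g y z))

-- A partition of Fin n into h classes M_i = { v | cls v ≡ i } is a
-- congruence partition when every class is a transitive module
-- (in particular nonempty).
IsCongruencePartition : ∀ {n h} → (Fin n → Fin n → Set) → (Fin n → Fin h) → Set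
IsCongruencePartition {n} {h} E cls =
  ∀ (i : Fin h) → IsTransitiveModule (finGraph n E) (λ v → cls v ≡ i)

quotientGraph : ∀ {n h} → (Fin n → Fin n → Set) → (Fin n → Fin h) → Graph
quotientGraph {n} {h} E cls =
  graph (Fin h)
        (λ i j → i ≢ j × Σ[ u ∈ Fin n ] Σ[ v ∈ Fin n ] (cls u ≡ i × cls v ≡ j × E u v))

-- Module-induced graph G_i: the subgraph induced by M_i, augmented with a
-- virtual source (if addS) having edges to all of M_i and a virtual sink
-- (if addT) having edges from all of M_i.
ModuleVertex : ∀ {n h} → (Fin n → Fin h) → Fin h → Bool → Bool → Set
ModuleVertex {n} cls i addS addT =
  T addS ⊎ ((Σ[ v ∈ Fin n ] cls v ≡ i) ⊎ T addT)

moduleEdge : ∀ {n h} (E : Fin n → Fin n → Set) (cls : Fin n → Fin h) (i : Fin h)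
  (addS addT : Bool) → ModuleVertex cls i addS addT → ModuleVertex cls i addS addT → Set
moduleEdge E cls i addS addT (inj₁ _) (inj₂ (inj₁ _)) = ⊤
moduleEdge E cls i addS addT (inj₂ (inj₁ (u , _))) (inj₂ (inj₁ (v , _))) = E u v
moduleEdge E cls i addS addT (inj₂ (inj₁ _)) (inj₂ (inj₂ _)) = ⊤
moduleEdge E cls i addS addT _ _ = ⊥

moduleGraph : ∀ {n h} → (Fin n → Fin n → Set) → (Fin n → Fin h) → Fin h →
  Bool → Bool → Graph
moduleGraph E cls i addS addT =
  graph (ModuleVertex cls i addS addT) (moduleEdge E cls i addS addT)

-- w_N is the dimensional neck of G(C_P) = {G_0, G_1, ..., G_h}:
-- the maximum width of a graph in the family.
-- aug i = (addS , addT) is the augmentation used for G_i.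
IsDimensionalNeck : ∀ {n h} → (Fin n → Fin n → Set) → (Fin n → Fin h) →
  (Fin h → Bool × Bool) → ℕ → Set
IsDimensionalNeck E cls aug wN =
  let G₀ = quotientGraph E cls
      Gi = λ i → moduleGraph E cls i (proj₁ (aug i)) (Data.Product.proj₂ (aug i))
  in
  ((Σ[ w ∈ ℕ ] (IsWidth G₀ w × w ≤ wN)) ×
   (∀ i → Σ[ w ∈ ℕ ] (IsWidth (Gi i) w × w ≤ wN))) ×
  (IsWidth G₀ wN ⊎ Σ[ i ∈ Fin _ ] IsWidth (Gi i) wN)

IsDominanceDrawing : ∀ {n} → (Fin n → Fin n → Set) → (d : ℕ) → (Fin d → Fin n → ℕ) → Set
IsDominanceDrawing {n} E d D =
  ∀ u v → Reach (finGraph n E) u v ⇔ (∀ g → D g u ≤ D g v)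

HasDominanceDrawing : ∀ {n} → (Fin n → Fin n → Set) → ℕ → Set
HasDominanceDrawing {n} E d = Σ[ D ∈ (Fin d → Fin n → ℕ) ] IsDominanceDrawing E d D

IsDominanceDimension : ∀ {n} → (Fin n → Fin n → Set) → ℕ → Set
IsDominanceDimension E d =
  HasDominanceDrawing E d × (∀ d' → HasDominanceDrawing E d' → d ≤ d')

module Submission where

-- Reachability u ≼ v is a partial order, and a d-dimensional dominance drawing is exactly a realizer
-- of it by d coordinate functions; so d_G ≤ k as soon as some k-coordinate realizer exists. By
-- Dilworth's theorem (Tverberg's proof) a poset of width at most k is covered by k chains, and a chain
-- cover gives a realizer whose coordinate g counts the elements of chain g below a vertex.
-- For d_G ≤ w_N, cover G₀ and every module by w_N chains and combine the resulting realizers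
-- lexicographically, that of G₀ made strictly monotone by adding ranks; this is sound because the
-- order between vertices of different modules only depends on their modules. For 2 d_G ≤ n, either the width is at most ⌊n/2⌋, or there is an
-- antichain A of ⌊n/2⌋ + 1 vertices; then s, t and A have a 2-dimensional realizer, and each of the
-- n − |A| − 2 remaining vertices costs one more coordinate, for at most n − |A| ≤ ⌊n/2⌋ in total.

open import Defs
open import Axiom.UniquenessOfIdentityProofs using (module Decidable⇒UIP)
open import Data.Bool using (Bool; true; false; T; _∧_; not; if_then_else_)
open import Data.Bool.ListAction using (any)
open import Data.Bool.Properties using (T?; T-∧)
open import Data.Empty using (⊥-elim)
open import Data.Fin using (Fin; zero; suc; toℕ; fromℕ<) renaming (_≟_ to _≟ᶠ_)
open import Data.Fin.Properties using (all?; any?; toℕ<n; toℕ-fromℕ<; toℕ-injective)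
open import Data.List using (List; []; _∷_; length; map; filter; allFin; upTo)
open import Data.List.Extrema.Nat
  using (argmax; argmin; max; argmax-all; argmin-all; f[xs]≤f[argmax]; f[argmin]≤f[xs]; xs≤max; max≤v⁺)
import Data.List.Membership.DecPropositional as DecMembership
open import Data.List.Membership.Propositional using (_∈_; _∉_; lose; find)
open import Data.List.Membership.Propositional.Properties
  using (∈-allFin; ∈-map⁺; ∈-map⁻; ∈-upTo⁺; ∈-filter⁺; ∈-filter⁻)
open import Data.List.Properties using (length-map; length-upTo; length-tabulate)
open import Data.List.Relation.Binary.Subset.Propositional using (_⊆_)
open import Data.List.Relation.Unary.All as All using (All; []; _∷_)
import Data.List.Relation.Unary.All.Properties as All
open import Data.List.Relation.Unary.AllPairs using ([]; _∷_)
open import Data.List.Relation.Unary.Any as Any using (Any; here; there)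
open import Data.List.Relation.Unary.Any.Properties using (any⁺; any⁻)
open import Data.List.Relation.Unary.Unique.Propositional using (Unique)
open import Data.Nat
  using (ℕ; zero; suc; _+_; _*_; _∸_; _≤_; _<_; z≤n; s≤s; s≤s⁻¹; _≤?_; _≟_; _≡ᵇ_; ⌊_/2⌋; ⌈_/2⌉)
open import Data.Nat.Induction using (<-wellFounded)
open import Data.Nat.Properties
open import Data.Product using (Σ-syntax; ∃; _×_; _,_; proj₁; proj₂)
open import Data.Sum using (_⊎_; inj₁; inj₂; [_,_])
open import Data.Vec.Functional using (updateAt)
open import Data.Vec.Functional.Properties using (updateAt-updates; updateAt-minimal)
open import Function using (_∘_; const; _on_)
open import Function.Bundles using (_⇔_; mk⇔; Equivalence)
open import Function.Properties.Equivalence using (⇔-setoid)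
open import Induction.WellFounded using (Acc; acc)
open import Level using (0ℓ)
import Relation.Binary.Construct.On as On
open import Relation.Binary.PropositionalEquality using (_≡_; _≢_; refl; sym; trans; cong; subst; subst₂)
import Relation.Binary.Reasoning.Setoid as SetoidReasoning
open import Relation.Nullary using (¬_; Dec; yes; no; contradiction)
open import Relation.Nullary.Decidable
  using (toWitness; fromWitness; toWitnessFalse; fromWitnessFalse; ⌊_⌋; _×-dec_; _⊎-dec_; ¬?)

∧-intro : ∀ {a b} → T a → T b → T (a ∧ b)
∧-intro {a} {b} p q = Equivalence.from (T-∧ {a} {b}) (p , q)

∧-fst : ∀ {a b} → T (a ∧ b) → T a
∧-fst {a} {b} = proj₁ ∘ Equivalence.to (T-∧ {a} {b})

∧-snd : ∀ {a b} → T (a ∧ b) → T b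
∧-snd {a} {b} = proj₂ ∘ Equivalence.to (T-∧ {a} {b})

not-intro : ∀ {b} → ¬ T b → T (not b)
not-intro {true}  ¬b = ¬b _
not-intro {false} _  = _

not-elim : ∀ {b} → T (not b) → ¬ T b
not-elim {true}  ()
not-elim {false} _ ()

module _ {a} {A : Set a} where

  count : (A → Bool) → List A → ℕ
  count p [] = 0
  count p (x ∷ xs) = if p x then suc (count p xs) else count p xs

  count≤length : ∀ p xs → count p xs ≤ length xs
  count≤length p [] = z≤n
  count≤length p (x ∷ xs) with p x
  ... | true  = s≤s (count≤length p xs)
  ... | false = m≤n⇒m≤1+n (count≤length p xs)

  count-mono : ∀ {p q} → (∀ x → T (p x) → T (q x)) → ∀ xs → count p xs ≤ count q xs
  count-mono p⊆q [] = z≤n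
  count-mono {p} {q} p⊆q (x ∷ xs) with p x | q x | p⊆q x
  ... | true  | true  | _  = s≤s (count-mono p⊆q xs)
  ... | true  | false | pq = ⊥-elim (pq _)
  ... | false | true  | _  = m≤n⇒m≤1+n (count-mono p⊆q xs)
  ... | false | false | _  = count-mono p⊆q xs

  count-< : ∀ {p q y} → (∀ x → T (p x) → T (q x)) → ∀ {xs} → y ∈ xs → T (q y) → ¬ T (p y) →
    count p xs < count q xs
  count-< {p} {q} p⊆q {x ∷ xs} (here refl) qx ¬px with p x | q x
  ... | true  | _     = ⊥-elim (¬px _)
  ... | false | true  = s≤s (count-mono p⊆q xs)
  ... | false | false = ⊥-elim qx
  count-< {p} {q} p⊆q {x ∷ xs} (there y∈) qy ¬py with p x | q x | p⊆q x
  ... | true  | true  | _  = s≤s (count-< p⊆q y∈ qy ¬py)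
  ... | true  | false | pq = ⊥-elim (pq _)
  ... | false | true  | _  = m≤n⇒m≤1+n (count-< p⊆q y∈ qy ¬py)
  ... | false | false | _  = count-< p⊆q y∈ qy ¬py

  listMax : (A → ℕ) → List A → ℕ
  listMax f xs = max 0 (map f xs)

  ≤-listMax : ∀ (f : A → ℕ) {xs y} → y ∈ xs → f y ≤ listMax f xs
  ≤-listMax f {xs} y∈ = All.lookup (xs≤max 0 (map f xs)) (∈-map⁺ f y∈)

  listMax-≤ : ∀ (f : A → ℕ) {xs b} → (∀ {y} → y ∈ xs → f y ≤ b) → listMax f xs ≤ b
  listMax-≤ f f≤b = max≤v⁺ z≤n (All.map⁺ (All.tabulate f≤b))

  remove : ∀ {x : A} {ys} → x ∈ ys → List A
  remove {ys = y ∷ ys} (here _)  = ys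
  remove {ys = y ∷ ys} (there p) = y ∷ remove p

  length-remove : ∀ {x : A} {ys} (p : x ∈ ys) → suc (length (remove p)) ≡ length ys
  length-remove (here _)  = refl
  length-remove (there p) = cong suc (length-remove p)

  ∈-remove : ∀ {x y : A} {ys} (p : x ∈ ys) → y ∈ ys → y ≢ x → y ∈ remove p
  ∈-remove (here refl) (here refl) y≢x = contradiction refl y≢x
  ∈-remove (here refl) (there q)   _   = q
  ∈-remove (there p)   (here refl) _   = here refl
  ∈-remove (there p)   (there q)   y≢x = there (∈-remove p q y≢x)

  Unique-⊆⇒length≤ : ∀ {xs ys : List A} → Unique xs → xs ⊆ ys → length xs ≤ length ys
  Unique-⊆⇒length≤ {[]}     []              _  = z≤n
  Unique-⊆⇒length≤ {x ∷ xs} (x∉xs ∷ unique) xs⊆ys =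
    subst (suc (length xs) ≤_) (length-remove x∈ys)
      (s≤s (Unique-⊆⇒length≤ unique λ z∈xs →
        ∈-remove x∈ys (xs⊆ys (there z∈xs)) λ { refl → All.lookup x∉xs z∈xs refl }))
    where x∈ys = xs⊆ys (here refl)

  Unique-map⁺ : ∀ {b} {B : Set b} (f : A → B) {xs} → Unique xs →
    (∀ {x y} → x ∈ xs → y ∈ xs → f x ≡ f y → x ≡ y) → Unique (map f xs)
  Unique-map⁺ f {[]}     []              _   = []
  Unique-map⁺ f {x ∷ xs} (x∉xs ∷ unique) inj =
    All.tabulate (λ fy∈ fx≡fy →
      let y , y∈xs , fy≡ = ∈-map⁻ f fy∈
      in All.lookup x∉xs y∈xs (inj (here refl) (there y∈xs) (trans fx≡fy fy≡)))
    ∷ Unique-map⁺ f unique (λ x∈ y∈ → inj (there x∈) (there y∈))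

injective⇒surjective : ∀ {a} {A : Set a} (f : A → ℕ) {xs k} → Unique xs → length xs ≡ k →
  (∀ {x} → x ∈ xs → f x < k) → (∀ {x y} → x ∈ xs → y ∈ xs → f x ≡ f y → x ≡ y) →
  ∀ {c} → c < k → ∃ λ x → x ∈ xs × f x ≡ c
injective⇒surjective f {xs} {k} unique refl f<k inj {c} c<k
  with Any.any? (λ x → f x ≟ c) xs
... | yes hit = find hit
... | no miss = ⊥-elim (<-irrefl (length-map f xs)
                  (≤-trans (Unique-⊆⇒length≤ (c∉ ∷ Unique-map⁺ f unique inj) ⊆upTo)
                           (≤-reflexive (length-upTo k))))
  where
    c∉ : All (c ≢_) (map f xs)
    c∉ = All.tabulate λ fy∈ c≡fy →
      let y , y∈xs , fy≡ = ∈-map⁻ f fy∈ in miss (lose y∈xs (sym (trans c≡fy fy≡)))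
    ⊆upTo : c ∷ map f xs ⊆ upTo k
    ⊆upTo (here refl) = ∈-upTo⁺ c<k
    ⊆upTo (there fy∈) with ∈-map⁻ f fy∈
    ... | _ , y∈xs , refl = ∈-upTo⁺ (f<k y∈xs)

onlyIf : Bool → ℕ → ℕ
onlyIf true  k = k
onlyIf false _ = 0

onlyIf-true : ∀ {b} k → T b → onlyIf b k ≡ k
onlyIf-true {true} k _ = refl

onlyIf-false : ∀ {b} k → ¬ T b → onlyIf b k ≡ 0
onlyIf-false {true}  k ¬b = contradiction _ ¬b
onlyIf-false {false} k _  = refl

onlyIf-mono : ∀ {a b} k → (T a → T b) → onlyIf a k ≤ onlyIf b k
onlyIf-mono {false}        k _   = z≤n
onlyIf-mono {true} {true}  k _   = ≤-refl
onlyIf-mono {true} {false} k a⇒b = contradiction _ a⇒b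

m+3+⌊n/2⌋≤1+n⇒m<⌊n/2⌋ : ∀ m n → m + (3 + ⌊ n /2⌋) ≤ suc n → m < ⌊ n /2⌋
m+3+⌊n/2⌋≤1+n⇒m<⌊n/2⌋ m n bound = +-cancelʳ-≤ ⌊ n /2⌋ (suc m) ⌊ n /2⌋ (s≤s⁻¹ (s≤s⁻¹ (begin
  3 + (m + ⌊ n /2⌋)             ≡⟨ sym (trans (+-suc m _) (cong suc (trans (+-suc m _) (cong suc (+-suc m _))))) ⟩
  m + (3 + ⌊ n /2⌋)             ≤⟨ bound ⟩
  suc n                         ≡⟨ cong suc (sym (⌊n/2⌋+⌈n/2⌉≡n n)) ⟩
  suc (⌊ n /2⌋ + ⌈ n /2⌉)       ≤⟨ s≤s (+-monoʳ-≤ ⌊ n /2⌋ (⌊n/2⌋-mono (n≤1+n (suc n)))) ⟩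
  suc (⌊ n /2⌋ + suc ⌊ n /2⌋)   ≡⟨ cong suc (+-suc ⌊ n /2⌋ ⌊ n /2⌋) ⟩
  2 + (⌊ n /2⌋ + ⌊ n /2⌋)       ∎)))
  where open ≤-Reasoning

≤⌊n/2⌋⇒2*≤ : ∀ {d n} → d ≤ ⌊ n /2⌋ → 2 * d ≤ n
≤⌊n/2⌋⇒2*≤ {d} {n} d≤ = begin
  2 * d                   ≡⟨ cong (d +_) (+-identityʳ d) ⟩
  d + d                   ≤⟨ +-mono-≤ d≤ (≤-trans d≤ (⌊n/2⌋≤⌈n/2⌉ n)) ⟩
  ⌊ n /2⌋ + ⌈ n /2⌉       ≡⟨ ⌊n/2⌋+⌈n/2⌉≡n n ⟩
  n                       ∎
  where open ≤-Reasoning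

lex-< : ∀ K {a b x y} → a < b → x < K → K * a + x < K * b + y
lex-< K {a} {b} {x} {y} a<b x<K = begin-strict
  K * a + x         <⟨ +-monoʳ-< (K * a) x<K ⟩
  K * a + K         ≡⟨ trans (+-comm (K * a) K) (sym (*-suc K a)) ⟩
  K * suc a         ≤⟨ *-monoʳ-≤ K a<b ⟩
  K * b             ≤⟨ m≤m+n (K * b) y ⟩
  K * b + y         ∎
  where open ≤-Reasoning

lex-≤⇒≤ : ∀ K {a b x y} → y < K → K * a + x ≤ K * b + y → a ≤ b
lex-≤⇒≤ K {a} {b} y<K lex≤ with a ≤? b
... | yes a≤b = a≤b
... | no a≰b = contradiction lex≤ (<⇒≱ (lex-< K (≰⇒> a≰b) y<K))

Unique⇒another : ∀ {n} {ys : List (Fin n)} → Unique ys → 2 ≤ length ys → ∀ x → ∃ λ y → y ∈ ys × y ≢ x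
Unique⇒another {ys = a ∷ a′ ∷ _} (a∉ ∷ _) _ x with a ≟ᶠ x
... | yes refl = a′ , there (here refl) , λ a′≡a → All.lookup a∉ (here refl) (sym a′≡a)
... | no a≢x   = a , here refl , a≢x
Unique⇒another {ys = _ ∷ []} _ (s≤s ()) _

Unique⇒length≤ : ∀ {n} {ys : List (Fin n)} → Unique ys → length ys ≤ n
Unique⇒length≤ {n} unique =
  ≤-trans (Unique-⊆⇒length≤ unique (λ {y} _ → ∈-allFin y)) (≤-reflexive (length-tabulate (λ i → i)))

module FinitePoset {n : ℕ} (_≼_ : Fin n → Fin n → Bool)
  (≼-refl : ∀ x → T (x ≼ x))
  (≼-trans : ∀ {x y z} → T (x ≼ y) → T (y ≼ z) → T (x ≼ z))
  (≼-antisym : ∀ {x y} → T (x ≼ y) → T (y ≼ x) → x ≡ y) where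

  open DecMembership (_≟ᶠ_ {n}) using (_∈?_)

  countBelow : (Fin n → Bool) → Fin n → ℕ
  countBelow P v = count (λ c → P c ∧ (c ≼ v)) (allFin n)

  countBelow≤n : ∀ (P : Fin n → Bool) v → countBelow P v ≤ n
  countBelow≤n P v = ≤-trans (count≤length _ (allFin n)) (≤-reflexive (length-tabulate (λ i → i)))

  countBelow-mono : ∀ (P : Fin n → Bool) {u v} → T (u ≼ v) → countBelow P u ≤ countBelow P v
  countBelow-mono P u≼v =
    count-mono (λ c Pc∧c≼u → ∧-intro (∧-fst Pc∧c≼u) (≼-trans (∧-snd Pc∧c≼u) u≼v)) (allFin n)

  countBelow-< : ∀ (P : Fin n → Bool) {u v} → T (P u) → ¬ T (u ≼ v) →
    (∀ c → T (P c) → T (c ≼ v) → T (c ≼ u)) → countBelow P v < countBelow P u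
  countBelow-< P {u} Pu u⋠v below = count-<
    (λ c Pc∧c≼v → ∧-intro (∧-fst Pc∧c≼v) (below c (∧-fst Pc∧c≼v) (∧-snd Pc∧c≼v)))
    (∈-allFin u) (∧-intro Pu (≼-refl u)) (u⋠v ∘ ∧-snd)

  rank : Fin n → ℕ
  rank = countBelow (const true)

  rank-< : ∀ {u v} → T (u ≼ v) → u ≢ v → rank u < rank v
  rank-< u≼v u≢v =
    countBelow-< (const true) _ (λ v≼u → u≢v (≼-antisym u≼v v≼u)) (λ _ _ c≼u → ≼-trans c≼u u≼v)

  maximal : ∀ (S : Fin n → Bool) {v} → T (S v) →
    Σ[ m ∈ Fin n ] T (S m) × (∀ {z} → T (S z) → T (m ≼ z) → z ≡ m)
  maximal S {v} Sv = m , Sm , is-max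
    where
      inS : List (Fin n)
      inS = filter (T? ∘ S) (allFin n)
      m : Fin n
      m = argmax rank v inS
      Sm : T (S m)
      Sm = argmax-all rank {xs = inS} Sv (All.tabulate (proj₂ ∘ ∈-filter⁻ (T? ∘ S) {xs = allFin n}))
      is-max : ∀ {z} → T (S z) → T (m ≼ z) → z ≡ m
      is-max {z} Sz m≼z with z ≟ᶠ m
      ... | yes z≡m = z≡m
      ... | no z≢m = contradiction (All.lookup (f[xs]≤f[argmax] v inS) (∈-filter⁺ (T? ∘ S) (∈-allFin z) Sz))
                                   (<⇒≱ (rank-< m≼z (z≢m ∘ sym)))

  minimalBelow : ∀ (S : Fin n → Bool) {m} → T (S m) →
    Σ[ b ∈ Fin n ] T (S b) × T (b ≼ m) × (∀ {z} → T (S z) → T (z ≼ b) → z ≡ b)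
  minimalBelow S {m} Sm = b , ∧-fst {S b} Sb∧b≼m , ∧-snd {S b} Sb∧b≼m , is-min
    where
      S↓m : Fin n → Bool
      S↓m c = S c ∧ (c ≼ m)
      inS↓m : List (Fin n)
      inS↓m = filter (T? ∘ S↓m) (allFin n)
      b : Fin n
      b = argmin rank m inS↓m
      Sb∧b≼m : T (S↓m b)
      Sb∧b≼m = argmin-all rank {xs = inS↓m} (∧-intro Sm (≼-refl m))
                 (All.tabulate (proj₂ ∘ ∈-filter⁻ (T? ∘ S↓m) {xs = allFin n}))
      is-min : ∀ {z} → T (S z) → T (z ≼ b) → z ≡ b
      is-min {z} Sz z≼b with z ≟ᶠ b
      ... | yes z≡b = z≡b
      ... | no z≢b = contradiction
              (All.lookup (f[argmin]≤f[xs] m inS↓m)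
                (∈-filter⁺ (T? ∘ S↓m) (∈-allFin z) (∧-intro Sz (≼-trans z≼b (∧-snd {S b} Sb∧b≼m)))))
              (<⇒≱ (rank-< z≼b z≢b))

  size : (Fin n → Bool) → ℕ
  size S = count S (allFin n)

  size-< : ∀ {S' S : Fin n → Bool} {x} → (∀ y → T (S' y) → T (S y)) → T (S x) → ¬ T (S' x) →
    size S' < size S
  size-< S'⊆S Sx ¬S'x = count-< S'⊆S (∈-allFin _) Sx ¬S'x

  record ChainCover (S : Fin n → Bool) (k : ℕ) : Set where
    field
      colour : Fin n → ℕ
      colour<k : ∀ {v} → T (S v) → colour v < k
      comparable : ∀ {u v} → T (S u) → T (S v) → colour u ≡ colour v → T (u ≼ v) ⊎ T (v ≼ u)

  record AntichainOf (S : Fin n → Bool) (ℓ : ℕ) : Set where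
    field
      elems : List (Fin n)
      unique : Unique elems
      elems⊆S : ∀ {x} → x ∈ elems → T (S x)
      incomparable : ∀ {x y} → x ∈ elems → y ∈ elems → x ≢ y → ¬ T (x ≼ y)
      length-elems : length elems ≡ ℓ

    ≼⇒≡ : ∀ {x y} → x ∈ elems → y ∈ elems → T (x ≼ y) → x ≡ y
    ≼⇒≡ {x} {y} x∈ y∈ x≼y with x ≟ᶠ y
    ... | yes x≡y = x≡y
    ... | no x≢y = contradiction x≼y (incomparable x∈ y∈ x≢y)

    comparable⇒≡ : ∀ {x y} → x ∈ elems → y ∈ elems → T (x ≼ y) ⊎ T (y ≼ x) → x ≡ y
    comparable⇒≡ x∈ y∈ = [ ≼⇒≡ x∈ y∈ , sym ∘ ≼⇒≡ y∈ x∈ ]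

  AntichainOf-mono : ∀ {S' S : Fin n → Bool} {ℓ} → (∀ x → T (S' x) → T (S x)) →
    AntichainOf S' ℓ → AntichainOf S ℓ
  AntichainOf-mono S'⊆S A = record
    { elems = elems ; unique = unique ; elems⊆S = S'⊆S _ ∘ elems⊆S
    ; incomparable = incomparable ; length-elems = length-elems }
    where open AntichainOf A

  DilworthResult : (Fin n → Bool) → ℕ → Set
  DilworthResult S k = ChainCover S k ⊎ AntichainOf S (suc k)

  ChainCover-addChain : ∀ {S S⁻ : Fin n → Bool} {b m k} → T (b ≼ m) →
    (∀ {x} → T (S x) → ¬ (x ≡ b ⊎ x ≡ m) → T (S⁻ x)) → ChainCover S⁻ k → ChainCover S (suc k)
  ChainCover-addChain {S} {S⁻} {b} {m} {k} b≼m S⊆S⁻∪bm C = record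
    { colour = colour′ ; colour<k = colour′<k ; comparable = comparable′ }
    where
      open ChainCover C
      onChain : ∀ x → Dec (x ≡ b ⊎ x ≡ m)
      onChain x = (x ≟ᶠ b) ⊎-dec (x ≟ᶠ m)
      colour′ : Fin n → ℕ
      colour′ x with onChain x
      ... | yes _ = k
      ... | no _  = colour x
      colour′<k : ∀ {v} → T (S v) → colour′ v < suc k
      colour′<k {v} Sv with onChain v
      ... | yes _   = ≤-refl
      ... | no  ¬bm = m≤n⇒m≤1+n (colour<k (S⊆S⁻∪bm Sv ¬bm))
      chain : ∀ {u v} → u ≡ b ⊎ u ≡ m → v ≡ b ⊎ v ≡ m → T (u ≼ v) ⊎ T (v ≼ u)
      chain (inj₁ refl) (inj₁ refl) = inj₁ (≼-refl b)
      chain (inj₁ refl) (inj₂ refl) = inj₁ b≼m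
      chain (inj₂ refl) (inj₁ refl) = inj₂ b≼m
      chain (inj₂ refl) (inj₂ refl) = inj₁ (≼-refl m)
      comparable′ : ∀ {u v} → T (S u) → T (S v) → colour′ u ≡ colour′ v → T (u ≼ v) ⊎ T (v ≼ u)
      comparable′ {u} {v} Su Sv same with onChain u | onChain v
      ... | yes u∈ | yes v∈ = chain u∈ v∈
      ... | yes _  | no v∉  = contradiction (sym same) (<⇒≢ (colour<k (S⊆S⁻∪bm Sv v∉)))
      ... | no u∉  | yes _  = contradiction same (<⇒≢ (colour<k (S⊆S⁻∪bm Su u∉)))
      ... | no u∉  | no v∉  = comparable (S⊆S⁻∪bm Su u∉) (S⊆S⁻∪bm Sv v∉) same

  module AroundAntichain (S : Fin n → Bool) {k} (A : AntichainOf S k) where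
    open AntichainOf A

    Down Up : Fin n → Bool
    Down x = S x ∧ any (x ≼_) elems
    Up   x = S x ∧ any (_≼ x) elems

    Down⊆S : ∀ x → T (Down x) → T (S x)
    Down⊆S x = ∧-fst {S x}

    Up⊆S : ∀ x → T (Up x) → T (S x)
    Up⊆S x = ∧-fst {S x}

    Down-intro : ∀ {x a} → T (S x) → a ∈ elems → T (x ≼ a) → T (Down x)
    Down-intro Sx a∈ x≼a = ∧-intro Sx (any⁺ _ (lose a∈ x≼a))

    Up-intro : ∀ {x a} → T (S x) → a ∈ elems → T (a ≼ x) → T (Up x)
    Up-intro Sx a∈ a≼x = ∧-intro Sx (any⁺ _ (lose a∈ a≼x))

    Down-elim : ∀ {x} → T (Down x) → ∃ λ a → a ∈ elems × T (x ≼ a)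
    Down-elim {x} Dx = find (any⁻ _ elems (∧-snd {S x} Dx))

    Up-elim : ∀ {x} → T (Up x) → ∃ λ a → a ∈ elems × T (a ≼ x)
    Up-elim {x} Ux = find (any⁻ _ elems (∧-snd {S x} Ux))

    elems⊆Down : ∀ {a} → a ∈ elems → T (Down a)
    elems⊆Down {a} a∈ = Down-intro (elems⊆S a∈) a∈ (≼-refl a)

    elems⊆Up : ∀ {a} → a ∈ elems → T (Up a)
    elems⊆Up {a} a∈ = Up-intro (elems⊆S a∈) a∈ (≼-refl a)

    size-Down< : ∀ {m} → T (S m) → (∀ {z} → T (S z) → T (m ≼ z) → z ≡ m) → m ∉ elems → size Down < size S
    size-Down< Sm m-max m∉ = size-< Down⊆S Sm λ Dm →
      let a , a∈ , m≼a = Down-elim Dm in m∉ (subst (_∈ elems) (m-max (elems⊆S a∈) m≼a) a∈)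

    size-Up< : ∀ {b} → T (S b) → (∀ {z} → T (S z) → T (z ≼ b) → z ≡ b) → b ∉ elems → size Up < size S
    size-Up< Sb b-min b∉ = size-< Up⊆S Sb λ Ub →
      let a , a∈ , a≼b = Up-elim Ub in b∉ (subst (_∈ elems) (b-min (elems⊆S a∈) a≼b) a∈)

    extend : ∀ {x} → T (S x) → ¬ T (Down x) → ¬ T (Up x) → AntichainOf S (suc k)
    extend {x} Sx ¬Dx ¬Ux = record
      { elems = x ∷ elems
      ; unique = All.tabulate (λ a∈ x≡a → ¬Dx (Down-intro Sx a∈ (subst (λ a → T (x ≼ a)) x≡a (≼-refl x))))
                 ∷ unique
      ; elems⊆S = λ { (here refl) → Sx ; (there a∈) → elems⊆S a∈ }
      ; incomparable = λ
          { (here refl) (here refl) x≢x _ → x≢x refl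
          ; (here refl) (there a∈) _ x≼a → ¬Dx (Down-intro Sx a∈ x≼a)
          ; (there a∈) (here refl) _ a≼x → ¬Ux (Up-intro Sx a∈ a≼x)
          ; (there a∈) (there a′∈) → incomparable a∈ a′∈ }
      ; length-elems = cong suc length-elems
      }

    covered⊎extension : (∀ {x} → T (S x) → T (Down x) ⊎ T (Up x)) ⊎ AntichainOf S (suc k)
    covered⊎extension with any? (λ x → T? (S x) ×-dec ¬? (T? (Down x)) ×-dec ¬? (T? (Up x)))
    ... | yes (x , Sx , ¬Dx , ¬Ux) = inj₂ (extend Sx ¬Dx ¬Ux)
    ... | no none = inj₁ covered
      where
        covered : ∀ {x} → T (S x) → T (Down x) ⊎ T (Up x)
        covered {x} Sx with T? (Down x) | T? (Up x)
        ... | yes Dx | _      = inj₁ Dx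
        ... | no _   | yes Ux = inj₂ Ux
        ... | no ¬Dx | no ¬Ux = contradiction (x , Sx , ¬Dx , ¬Ux) none

    module Glue (covered : ∀ {x} → T (S x) → T (Down x) ⊎ T (Up x))
                (C↓ : ChainCover Down k) (C↑ : ChainCover Up k) where
      open ChainCover C↓ renaming (colour to c↓; colour<k to c↓<k; comparable to comparable↓)
      open ChainCover C↑ renaming (colour to c↑; colour<k to c↑<k; comparable to comparable↑)

      -- Each of the k chains of C↑ meets the k-antichain in exactly one element.
      anchor : ∀ {c} → c < k → ∃ λ a → a ∈ elems × c↑ a ≡ c
      anchor = injective⇒surjective c↑ unique length-elems (c↑<k ∘ elems⊆Up) λ a∈ a′∈ same →
        comparable⇒≡ a∈ a′∈ (comparable↑ (elems⊆Up a∈) (elems⊆Up a′∈) same)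

      colour : Fin n → ℕ
      colour x with T? (Down x) | T? (Up x)
      ... | yes _ | _      = c↓ x
      ... | no _  | yes Ux = c↓ (proj₁ (anchor (c↑<k Ux)))
      ... | no _  | no _   = 0

      colour-Down : ∀ {x} → T (Down x) → colour x ≡ c↓ x
      colour-Down {x} Dx with T? (Down x)
      ... | yes _ = refl
      ... | no ¬Dx = contradiction Dx ¬Dx

      colour-Up : ∀ {x} → ¬ T (Down x) → T (Up x) → ∃ λ a → a ∈ elems × c↑ a ≡ c↑ x × colour x ≡ c↓ a
      colour-Up {x} ¬Dx Ux with T? (Down x) | T? (Up x)
      ... | yes Dx | _      = contradiction Dx ¬Dx
      ... | no _   | no ¬Ux = contradiction Ux ¬Ux
      ... | no _   | yes Ux′ = let a , a∈ , c↑a≡ = anchor (c↑<k Ux′) in a , a∈ , c↑a≡ , refl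

      Down≼Up : ∀ {x y a} → T (Down x) → ¬ T (Down y) → T (Up y) → a ∈ elems →
        c↓ x ≡ c↓ a → c↑ a ≡ c↑ y → T (x ≼ y)
      Down≼Up {x} {y} {a} Dx ¬Dy Uy a∈ c↓x≡ c↑a≡ = ≼-trans x≼a a≼y
        where
          a≼y : T (a ≼ y)
          a≼y with comparable↑ (elems⊆Up a∈) Uy c↑a≡
          ... | inj₁ a≼y = a≼y
          ... | inj₂ y≼a = contradiction (Down-intro (Up⊆S y Uy) a∈ y≼a) ¬Dy
          x≼a : T (x ≼ a)
          x≼a with comparable↓ Dx (elems⊆Down a∈) c↓x≡
          ... | inj₁ x≼a = x≼a
          ... | inj₂ a≼x = let a′ , a′∈ , x≼a′ = Down-elim Dx
                           in subst (λ z → T (x ≼ z)) (sym (≼⇒≡ a∈ a′∈ (≼-trans a≼x x≼a′))) x≼a′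

      glued : ChainCover S k
      glued = record { colour = colour ; colour<k = colour<k ; comparable = comparable }
        where
          split : ∀ {x} → T (S x) → T (Down x) ⊎ (¬ T (Down x) × T (Up x))
          split {x} Sx with T? (Down x)
          ... | yes Dx = inj₁ Dx
          ... | no ¬Dx = inj₂ (¬Dx , [ (λ Dx → contradiction Dx ¬Dx) , (λ Ux → Ux) ] (covered Sx))
          colour<k : ∀ {v} → T (S v) → colour v < k
          colour<k Sv with split Sv
          ... | inj₁ Dv = subst (_< k) (sym (colour-Down Dv)) (c↓<k Dv)
          ... | inj₂ (¬Dv , Uv) = let a , a∈ , _ , colour≡ = colour-Up ¬Dv Uv
                                  in subst (_< k) (sym colour≡) (c↓<k (elems⊆Down a∈))
          comparable : ∀ {u v} → T (S u) → T (S v) → colour u ≡ colour v → T (u ≼ v) ⊎ T (v ≼ u)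
          comparable Su Sv same with split Su | split Sv
          ... | inj₁ Du | inj₁ Dv = comparable↓ Du Dv (trans (sym (colour-Down Du)) (trans same (colour-Down Dv)))
          ... | inj₁ Du | inj₂ (¬Dv , Uv) =
            let a , a∈ , c↑a≡ , colour≡ = colour-Up ¬Dv Uv
            in inj₁ (Down≼Up Du ¬Dv Uv a∈ (trans (sym (colour-Down Du)) (trans same colour≡)) c↑a≡)
          ... | inj₂ (¬Du , Uu) | inj₁ Dv =
            let a , a∈ , c↑a≡ , colour≡ = colour-Up ¬Du Uu
            in inj₂ (Down≼Up Dv ¬Du Uu a∈ (trans (sym (colour-Down Dv)) (trans (sym same) colour≡)) c↑a≡)
          ... | inj₂ (¬Du , Uu) | inj₂ (¬Dv , Uv) =
            let a , a∈ , c↑a≡ , colour≡ = colour-Up ¬Du Uu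
                a′ , a′∈ , c↑a′≡ , colour≡′ = colour-Up ¬Dv Uv
                a≡a′ = comparable⇒≡ a∈ a′∈ (comparable↓ (elems⊆Down a∈) (elems⊆Down a′∈)
                                                          (trans (sym colour≡) (trans same colour≡′)))
            in comparable↑ Uu Uv (trans (sym c↑a≡) (trans (cong c↑ a≡a′) c↑a′≡))

  -- Tverberg's induction: for m maximal and b ≼ m minimal, either S ∖ {b, m} is covered by k chains,
  -- or it has a (k+1)-antichain A and S is covered by the strictly smaller S ∩ ↓A and S ∩ ↑A.
  module DilworthStep (S : Fin n → Bool) (ih : ∀ {S'} → size S' < size S → ∀ k → DilworthResult S' k)
    {m} (Sm : T (S m)) (m-max : ∀ {z} → T (S z) → T (m ≼ z) → z ≡ m)
    {b} (Sb : T (S b)) (b≼m : T (b ≼ m)) (b-min : ∀ {z} → T (S z) → T (z ≼ b) → z ≡ b)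
    (k : ℕ) where

    onChain : ∀ x → Dec (x ≡ b ⊎ x ≡ m)
    onChain x = (x ≟ᶠ b) ⊎-dec (x ≟ᶠ m)

    S⁻ : Fin n → Bool
    S⁻ x = S x ∧ not ⌊ onChain x ⌋

    S⁻⊆S : ∀ x → T (S⁻ x) → T (S x)
    S⁻⊆S x = ∧-fst {S x}

    S⁻-intro : ∀ {x} → T (S x) → ¬ (x ≡ b ⊎ x ≡ m) → T (S⁻ x)
    S⁻-intro Sx ∉bm = ∧-intro Sx (fromWitnessFalse ∉bm)

    S⁻-elim : ∀ {x} → T (S⁻ x) → ¬ (x ≡ b ⊎ x ≡ m)
    S⁻-elim {x} S⁻x = toWitnessFalse (∧-snd {S x} S⁻x)

    module _ (A⁻ : AntichainOf S⁻ (suc k)) where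
      open AroundAntichain S (AntichainOf-mono S⁻⊆S A⁻)

      m∉ : m ∉ AntichainOf.elems A⁻
      m∉ m∈ = S⁻-elim (AntichainOf.elems⊆S A⁻ m∈) (inj₂ refl)

      b∉ : b ∉ AntichainOf.elems A⁻
      b∉ b∈ = S⁻-elim (AntichainOf.elems⊆S A⁻ b∈) (inj₁ refl)

      beyondAntichain : DilworthResult S (suc k)
      beyondAntichain
        with covered⊎extension | ih (size-Down< Sm m-max m∉) (suc k) | ih (size-Up< Sb b-min b∉) (suc k)
      ... | inj₂ A       | _       | _       = inj₂ A
      ... | inj₁ _       | inj₂ B  | _       = inj₂ (AntichainOf-mono Down⊆S B)
      ... | inj₁ _       | inj₁ _  | inj₂ B  = inj₂ (AntichainOf-mono Up⊆S B)
      ... | inj₁ covered | inj₁ C↓ | inj₁ C↑ = inj₁ (Glue.glued covered C↓ C↑)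

    result : DilworthResult S (suc k)
    result with ih (size-< S⁻⊆S Sm λ S⁻m → S⁻-elim S⁻m (inj₂ refl)) k
    ... | inj₁ C  = inj₁ (ChainCover-addChain b≼m S⁻-intro C)
    ... | inj₂ A⁻ = beyondAntichain A⁻

  dilworth : ∀ (S : Fin n → Bool) k → DilworthResult S k
  dilworth S = go S (On.wellFounded size <-wellFounded S)
    where
      go : ∀ S → Acc (_<_ on size) S → ∀ k → DilworthResult S k
      go S (acc rec) k with any? (T? ∘ S)
      ... | no empty = inj₁ (record
            { colour = const 0
            ; colour<k = λ {v} Sv → contradiction (v , Sv) empty
            ; comparable = λ {u} Su _ _ → contradiction (u , Su) empty })
      ... | yes (v₀ , Sv₀) with k
      ...   | zero  = inj₂ (record
                { elems = v₀ ∷ [] ; unique = [] ∷ [] ; elems⊆S = λ { (here refl) → Sv₀ }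
                ; incomparable = λ { (here refl) (here refl) v₀≢v₀ → contradiction refl v₀≢v₀ }
                ; length-elems = refl })
      ...   | suc k′ =
        let m , Sm , m-max = maximal S Sv₀
            b , Sb , b≼m , b-min = minimalBelow S Sm
        in DilworthStep.result S (λ lt → go _ (rec lt)) Sm m-max Sb b≼m b-min k′

  RealizesOn : (Fin n → Set) → (k : ℕ) → (Fin k → Fin n → ℕ) → Set
  RealizesOn P k D = ∀ {u v} → P u → P v → T (u ≼ v) ⇔ (∀ g → D g u ≤ D g v)

  Realizes : (k : ℕ) → (Fin k → Fin n → ℕ) → Set
  Realizes k D = ∀ u v → T (u ≼ v) ⇔ (∀ g → D g u ≤ D g v)

  chainCount : ∀ {S k} → ChainCover S k → Fin k → Fin n → ℕ
  chainCount {S} C g = countBelow (λ c → S c ∧ (ChainCover.colour C c ≡ᵇ toℕ g))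

  chainCount≤n : ∀ {S k} (C : ChainCover S k) g v → chainCount C g v ≤ n
  chainCount≤n C g = countBelow≤n _

  chainCount-realizesOn : ∀ {S k} (C : ChainCover S k) → RealizesOn (T ∘ S) k (chainCount C)
  chainCount-realizesOn {S} {k} C {u} {v} Su _ = mk⇔ (λ u≼v g → countBelow-mono _ u≼v) reflect
    where
      open ChainCover C
      g : Fin k
      g = fromℕ< (colour<k Su)
      inChain-u : ∀ {c} → T (S c ∧ (colour c ≡ᵇ toℕ g)) → colour c ≡ colour u
      inChain-u {c} p = trans (≡ᵇ⇒≡ _ _ (∧-snd {S c} p)) (toℕ-fromℕ< (colour<k Su))
      reflect : (∀ g → chainCount C g u ≤ chainCount C g v) → T (u ≼ v)
      reflect below with T? (u ≼ v)
      ... | yes u≼v = u≼v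
      ... | no u⋠v = contradiction (below g) (<⇒≱ (countBelow-< _
              (∧-intro Su (≡⇒≡ᵇ _ _ (sym (toℕ-fromℕ< (colour<k Su))))) u⋠v
              λ c inChain c≼v → [ (λ c≼u → c≼u) , (λ u≼c → contradiction (≼-trans u≼c c≼v) u⋠v) ]
                                 (comparable (∧-fst {S c} inChain) Su (inChain-u inChain))))

  -- In the first copy of coordinate 0 the new point x sits above every point not above it, in the
  -- second below every point not below it; in the other coordinates it sits at the top of its down-set.
  module AddPoint {L : List (Fin n)} {d} {D : Fin (suc d) → Fin n → ℕ}
                  (R : RealizesOn (_∈ L) (suc d) D) {x} (x∉L : x ∉ L) where
    top : ℕ
    top = listMax (D zero) L

    high low : Fin n → ℕ
    high = updateAt (λ v → onlyIf (x ≼ v) (suc top) + D zero v) x (const (suc top))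
    low  = updateAt (λ v → onlyIf (not (v ≼ x)) (suc top) + D zero v) x (const top)

    rest : Fin (suc d) → Fin n → ℕ
    rest g = updateAt (D g) x (const (listMax (λ y → onlyIf (y ≼ x) (D g y)) L))

    D⁺ : Fin (suc (suc d)) → Fin n → ℕ
    D⁺ zero          = high
    D⁺ (suc zero)    = low
    D⁺ (suc (suc g)) = rest (suc g)

    ≢x : ∀ {v} → v ∈ L → v ≢ x
    ≢x v∈ refl = x∉L v∈

    D₀≤top : ∀ {v} → v ∈ L → D zero v ≤ top
    D₀≤top = ≤-listMax (D zero)

    high-x : high x ≡ suc top
    high-x = updateAt-updates x _

    low-x : low x ≡ top
    low-x = updateAt-updates x _

    rest-x : ∀ g → rest g x ≡ listMax (λ y → onlyIf (y ≼ x) (D g y)) L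
    rest-x g = updateAt-updates x _

    high-L : ∀ {v} → v ∈ L → high v ≡ onlyIf (x ≼ v) (suc top) + D zero v
    high-L v∈ = updateAt-minimal _ x _ (≢x v∈)

    low-L : ∀ {v} → v ∈ L → low v ≡ onlyIf (not (v ≼ x)) (suc top) + D zero v
    low-L v∈ = updateAt-minimal _ x _ (≢x v∈)

    rest-L : ∀ g {v} → v ∈ L → rest g v ≡ D g v
    rest-L g v∈ = updateAt-minimal _ x _ (≢x v∈)

    high-above : ∀ {v} → v ∈ L → T (x ≼ v) → high v ≡ suc top + D zero v
    high-above {v} v∈ x≼v = trans (high-L v∈) (cong (_+ D zero v) (onlyIf-true _ x≼v))

    high-other : ∀ {v} → v ∈ L → ¬ T (x ≼ v) → high v ≡ D zero v
    high-other {v} v∈ x⋠v = trans (high-L v∈) (cong (_+ D zero v) (onlyIf-false _ x⋠v))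

    low-other : ∀ {v} → v ∈ L → ¬ T (v ≼ x) → low v ≡ suc top + D zero v
    low-other {v} v∈ v⋠x = trans (low-L v∈) (cong (_+ D zero v) (onlyIf-true _ (not-intro v⋠x)))

    low-below : ∀ {v} → v ∈ L → T (v ≼ x) → low v ≡ D zero v
    low-below {v} v∈ v≼x = trans (low-L v∈) (cong (_+ D zero v) (onlyIf-false _ λ v⋠x → not-elim v⋠x v≼x))

    monotone : ∀ {u v} → u ∈ L → v ∈ L → T (u ≼ v) → ∀ g → D g u ≤ D g v
    monotone u∈ v∈ = Equivalence.to (R u∈ v∈)

    x≼⇔ : ∀ {v} → v ∈ L → T (x ≼ v) ⇔ (∀ g → D⁺ g x ≤ D⁺ g v)
    x≼⇔ {v} v∈ = mk⇔ mono reflect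
      where
        mono : T (x ≼ v) → ∀ g → D⁺ g x ≤ D⁺ g v
        mono x≼v zero = subst₂ _≤_ (sym high-x) (sym (high-above v∈ x≼v)) (m≤m+n (suc top) (D zero v))
        mono x≼v (suc zero) =
          subst₂ _≤_ (sym low-x) (sym (low-other v∈ λ v≼x → ≢x v∈ (≼-antisym v≼x x≼v)))
          (≤-trans (n≤1+n top) (m≤m+n (suc top) (D zero v)))
        mono x≼v (suc (suc g)) = subst₂ _≤_ (sym (rest-x (suc g))) (sym (rest-L (suc g) v∈))
          (listMax-≤ _ λ {y} y∈ → below y y∈ (T? (y ≼ x)))
          where
            below : ∀ y → y ∈ L → Dec (T (y ≼ x)) → onlyIf (y ≼ x) (D (suc g) y) ≤ D (suc g) v
            below y y∈ (yes y≼x) = subst (_≤ D (suc g) v) (sym (onlyIf-true _ y≼x))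
                                     (monotone y∈ v∈ (≼-trans y≼x x≼v) (suc g))
            below y y∈ (no y⋠x) = subst (_≤ D (suc g) v) (sym (onlyIf-false _ y⋠x)) z≤n
        reflect : (∀ g → D⁺ g x ≤ D⁺ g v) → T (x ≼ v)
        reflect below with T? (x ≼ v)
        ... | yes x≼v = x≼v
        ... | no x⋠v = contradiction (subst₂ _≤_ high-x (high-other v∈ x⋠v) (below zero))
                                     (<⇒≱ (s≤s (D₀≤top v∈)))

    ≼x⇔ : ∀ {u} → u ∈ L → T (u ≼ x) ⇔ (∀ g → D⁺ g u ≤ D⁺ g x)
    ≼x⇔ {u} u∈ = mk⇔ mono reflect
      where
        mono : T (u ≼ x) → ∀ g → D⁺ g u ≤ D⁺ g x
        mono u≼x zero = subst₂ _≤_ (sym (high-other u∈ λ x≼u → ≢x u∈ (≼-antisym u≼x x≼u))) (sym high-x)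
          (≤-trans (D₀≤top u∈) (n≤1+n top))
        mono u≼x (suc zero) = subst₂ _≤_ (sym (low-below u∈ u≼x)) (sym low-x) (D₀≤top u∈)
        mono u≼x (suc (suc g)) = subst₂ _≤_ (sym (rest-L (suc g) u∈)) (sym (rest-x (suc g)))
          (subst (_≤ _) (onlyIf-true _ u≼x) (≤-listMax (λ y → onlyIf (y ≼ x) (D (suc g) y)) u∈))
        reflect : (∀ g → D⁺ g u ≤ D⁺ g x) → T (u ≼ x)
        reflect below with T? (u ≼ x)
        ... | yes u≼x = u≼x
        ... | no u⋠x = contradiction (subst₂ _≤_ (low-other u∈ u⋠x) low-x (below (suc zero)))
                                     (<⇒≱ (s≤s (m≤m+n top (D zero u))))

    L⇔ : ∀ {u v} → u ∈ L → v ∈ L → T (u ≼ v) ⇔ (∀ g → D⁺ g u ≤ D⁺ g v)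
    L⇔ {u} {v} u∈ v∈ = mk⇔ mono reflect
      where
        mono : T (u ≼ v) → ∀ g → D⁺ g u ≤ D⁺ g v
        mono u≼v zero = subst₂ _≤_ (sym (high-L u∈)) (sym (high-L v∈))
          (+-mono-≤ (onlyIf-mono _ λ x≼u → ≼-trans x≼u u≼v) (monotone u∈ v∈ u≼v zero))
        mono u≼v (suc zero) = subst₂ _≤_ (sym (low-L u∈)) (sym (low-L v∈))
          (+-mono-≤ (onlyIf-mono _ λ u⋠x → not-intro λ v≼x → not-elim u⋠x (≼-trans u≼v v≼x))
                    (monotone u∈ v∈ u≼v zero))
        mono u≼v (suc (suc g)) = subst₂ _≤_ (sym (rest-L (suc g) u∈)) (sym (rest-L (suc g) v∈))
          (monotone u∈ v∈ u≼v (suc g))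
        reflect : (∀ g → D⁺ g u ≤ D⁺ g v) → T (u ≼ v)
        reflect below = Equivalence.from (R u∈ v∈) λ
          { zero    → D₀≤ (T? (x ≼ u)) (T? (x ≼ v))
          ; (suc g) → subst₂ _≤_ (rest-L (suc g) u∈) (rest-L (suc g) v∈) (below (suc (suc g))) }
          where
            D₀≤ : Dec (T (x ≼ u)) → Dec (T (x ≼ v)) → D zero u ≤ D zero v
            D₀≤ (yes x≼u) (yes x≼v) =
              +-cancelˡ-≤ (suc top) _ _ (subst₂ _≤_ (high-above u∈ x≼u) (high-above v∈ x≼v) (below zero))
            D₀≤ (no x⋠u) (no x⋠v) = subst₂ _≤_ (high-other u∈ x⋠u) (high-other v∈ x⋠v) (below zero)
            D₀≤ (yes x≼u) (no x⋠v) = contradiction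
              (≤-trans (m≤m+n (suc top) (D zero u))
                       (subst₂ _≤_ (high-above u∈ x≼u) (high-other v∈ x⋠v) (below zero)))
              (<⇒≱ (s≤s (D₀≤top v∈)))
            D₀≤ (no x⋠u) (yes x≼v) with T? (u ≼ x)
            ... | yes u≼x = monotone u∈ v∈ (≼-trans u≼x x≼v) zero
            ... | no u⋠x = +-cancelˡ-≤ (suc top) _ _ (subst₂ _≤_
              (low-other u∈ u⋠x) (low-other v∈ λ v≼x → ≢x v∈ (≼-antisym v≼x x≼v)) (below (suc zero)))

    realizesOn : RealizesOn (_∈ x ∷ L) (suc (suc d)) D⁺
    realizesOn (here refl) (here refl) = mk⇔ (λ _ _ → ≤-refl) (λ _ → ≼-refl x)
    realizesOn (here refl) (there v∈)  = x≼⇔ v∈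
    realizesOn (there u∈)  (here refl) = ≼x⇔ u∈
    realizesOn (there u∈)  (there v∈)  = L⇔ u∈ v∈

  record Extension (vs L : List (Fin n)) (d : ℕ) : Set where
    field
      L⁺ : List (Fin n)
      d⁺ : ℕ
      D⁺ : Fin (suc d⁺) → Fin n → ℕ
      unique : Unique L⁺
      realizes : RealizesOn (_∈ L⁺) (suc d⁺) D⁺
      vs⊆L⁺ : vs ⊆ L⁺
      L⊆L⁺ : L ⊆ L⁺
      cost : d⁺ + length L ≤ d + length L⁺

  extension : ∀ vs {L d D} → Unique L → RealizesOn (_∈ L) (suc d) D → Extension vs L d
  extension [] {L} {d} {D} unique R = record
    { L⁺ = L ; d⁺ = d ; D⁺ = D ; unique = unique ; realizes = R
    ; vs⊆L⁺ = λ () ; L⊆L⁺ = λ v∈ → v∈ ; cost = ≤-refl }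
  extension (v ∷ vs) {L} {d} uniqueL R with v ∈? L
  ... | yes v∈L = record
    { L⁺ = L⁺ ; d⁺ = d⁺ ; D⁺ = D⁺ ; unique = unique ; realizes = realizes
    ; vs⊆L⁺ = λ { (here refl) → L⊆L⁺ v∈L ; (there w∈) → vs⊆L⁺ w∈ }
    ; L⊆L⁺ = L⊆L⁺ ; cost = cost }
    where open Extension (extension vs uniqueL R)
  ... | no v∉L = record
    { L⁺ = L⁺ ; d⁺ = d⁺ ; D⁺ = D⁺ ; unique = unique ; realizes = realizes
    ; vs⊆L⁺ = λ { (here refl) → L⊆L⁺ (here refl) ; (there w∈) → vs⊆L⁺ w∈ }
    ; L⊆L⁺ = L⊆L⁺ ∘ there
    ; cost = s≤s⁻¹ (≤-trans (≤-reflexive (sym (+-suc d⁺ (length L)))) cost) }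
    where
      v∷L-unique : Unique (v ∷ L)
      v∷L-unique = All.tabulate (λ w∈ v≡w → v∉L (subst (_∈ L) (sym v≡w) w∈)) ∷ uniqueL
      open Extension (extension vs v∷L-unique (AddPoint.realizesOn R v∉L))

  chainCount-realizes : ∀ {k} (C : ChainCover (const true) k) → Realizes k (chainCount C)
  chainCount-realizes C _ _ = chainCount-realizesOn C _ _

  module Bounded {s t} (s-least : ∀ v → T (s ≼ v)) (t-greatest : ∀ v → T (v ≼ t)) (s≢t : s ≢ t) where

    frame : (Fin n → ℕ) → Fin n → ℕ
    frame f = updateAt (updateAt f s (const 0)) t (const (suc n))

    frame-s : ∀ f → frame f s ≡ 0
    frame-s f = trans (updateAt-minimal s t _ s≢t) (updateAt-updates s f)

    frame-t : ∀ f → frame f t ≡ suc n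
    frame-t f = updateAt-updates t _

    frame-other : ∀ f {v} → v ≢ s → v ≢ t → frame f v ≡ f v
    frame-other f v≢s v≢t = trans (updateAt-minimal _ t _ v≢t) (updateAt-minimal _ s f v≢s)

    frame≤ : ∀ f → (∀ v → f v ≤ n) → ∀ v → frame f v ≤ suc n
    frame≤ f f≤n v with v ≟ᶠ s | v ≟ᶠ t
    ... | yes refl | _        = subst (_≤ suc n) (sym (frame-s f)) z≤n
    ... | no _     | yes refl = ≤-reflexive (frame-t f)
    ... | no v≢s   | no v≢t   = subst (_≤ suc n) (sym (frame-other f v≢s v≢t)) (m≤n⇒m≤1+n (f≤n v))

    -- On an antichain the two coordinates list its points in opposite orders.
    base : Fin 2 → Fin n → ℕ
    base zero       = frame (suc ∘ toℕ)
    base (suc zero) = frame (λ v → n ∸ toℕ v)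

    base≤ : ∀ g v → base g v ≤ suc n
    base≤ zero       = frame≤ _ toℕ<n
    base≤ (suc zero) = frame≤ _ λ v → m∸n≤m n (toℕ v)

    module _ {ℓ} (A : AntichainOf (const true) ℓ) (2≤ℓ : 2 ≤ ℓ) where
      open AntichainOf A

      another : ∀ x → ∃ λ y → y ∈ elems × y ≢ x
      another = Unique⇒another unique (subst (2 ≤_) (sym length-elems) 2≤ℓ)

      s∉ : s ∉ elems
      s∉ s∈ = let y , y∈ , y≢s = another s in incomparable s∈ y∈ (y≢s ∘ sym) (s-least y)

      t∉ : t ∉ elems
      t∉ t∈ = let y , y∈ , y≢t = another t in incomparable y∈ t∈ y≢t (t-greatest y)

      ≢s : ∀ {v} → v ∈ elems → v ≢ s
      ≢s v∈ refl = s∉ v∈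

      ≢t : ∀ {v} → v ∈ elems → v ≢ t
      ≢t v∈ refl = t∉ v∈

      frame-A : ∀ f {v} → v ∈ elems → frame f v ≡ f v
      frame-A f v∈ = frame-other f (≢s v∈) (≢t v∈)

      s∷t∷A-unique : Unique (s ∷ t ∷ elems)
      s∷t∷A-unique =
        (s≢t ∷ All.tabulate (λ v∈ → ≢s v∈ ∘ sym)) ∷ All.tabulate (λ v∈ → ≢t v∈ ∘ sym) ∷ unique

      separated : ∀ {u v} → ¬ T (u ≼ v) → base zero v < base zero u → T (u ≼ v) ⇔ (∀ g → base g u ≤ base g v)
      separated u⋠v v<u = mk⇔ (λ u≼v → contradiction u≼v u⋠v) (λ below → contradiction (below zero) (<⇒≱ v<u))

      base-realizesOn : RealizesOn (_∈ s ∷ t ∷ elems) 2 base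
      base-realizesOn {_} {v} (here refl) _ =
        mk⇔ (λ _ g → subst (_≤ base g v) (sym (base-s g)) z≤n) (λ _ → s-least v)
        where
          base-s : ∀ g → base g s ≡ 0
          base-s zero       = frame-s _
          base-s (suc zero) = frame-s _
      base-realizesOn {u} _ (there (here refl)) =
        mk⇔ (λ _ g → subst (base g u ≤_) (sym (base-t g)) (base≤ g u)) (λ _ → t-greatest u)
        where
          base-t : ∀ g → base g t ≡ suc n
          base-t zero       = frame-t _
          base-t (suc zero) = frame-t _
      base-realizesOn (there (here refl)) (here refl) =
        separated (λ t≼s → s≢t (≼-antisym (s-least t) t≼s))
                  (subst₂ _<_ (sym (frame-s _)) (sym (frame-t _)) (s≤s z≤n))
      base-realizesOn (there (here refl)) (there (there v∈)) =
        separated (λ t≼v → ≢t v∈ (≼-antisym (t-greatest _) t≼v))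
                  (subst₂ _<_ (sym (frame-A _ v∈)) (sym (frame-t _)) (s≤s (toℕ<n _)))
      base-realizesOn (there (there u∈)) (here refl) =
        separated (λ u≼s → ≢s u∈ (≼-antisym u≼s (s-least _)))
                  (subst₂ _<_ (sym (frame-s _)) (sym (frame-A _ u∈)) (s≤s z≤n))
      base-realizesOn {u} {v} (there (there u∈)) (there (there v∈)) = mk⇔ mono reflect
        where
          mono : T (u ≼ v) → ∀ g → base g u ≤ base g v
          mono u≼v g = ≤-reflexive (cong (base g) (≼⇒≡ u∈ v∈ u≼v))
          reflect : (∀ g → base g u ≤ base g v) → T (u ≼ v)
          reflect below =
            subst (λ w → T (u ≼ w)) (toℕ-injective (≤-antisym toℕu≤toℕv toℕv≤toℕu)) (≼-refl u)
            where
              toℕu≤toℕv : toℕ u ≤ toℕ v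
              toℕu≤toℕv = s≤s⁻¹ (subst₂ _≤_ (frame-A _ u∈) (frame-A _ v∈) (below zero))
              toℕv≤toℕu : toℕ v ≤ toℕ u
              toℕv≤toℕu with toℕ v ≤? toℕ u
              ... | yes v≤u = v≤u
              ... | no v≰u = contradiction (subst₂ _≤_ (frame-A _ u∈) (frame-A _ v∈) (below (suc zero)))
                                           (<⇒≱ (∸-monoʳ-< (≰⇒> v≰u) (<⇒≤ (toℕ<n v))))

    dimension≤⌊n/2⌋ : Σ[ k ∈ ℕ ] Σ[ D ∈ (Fin k → Fin n → ℕ) ] Realizes k D × k ≤ ⌊ n /2⌋
    dimension≤⌊n/2⌋ with dilworth (const true) ⌊ n /2⌋
    ... | inj₁ C = ⌊ n /2⌋ , chainCount C , chainCount-realizes C , ≤-refl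
    ... | inj₂ A = suc d⁺ , D⁺ , (λ u v → realizes (vs⊆L⁺ (∈-allFin u)) (vs⊆L⁺ (∈-allFin v))) , suc-d⁺≤
      where
        2≤|A| : 2 ≤ suc ⌊ n /2⌋
        2≤|A| = s≤s (⌊n/2⌋-mono (Unique⇒length≤ ((s≢t ∷ []) ∷ [] ∷ [])))
        open Extension (extension (allFin n) (s∷t∷A-unique A 2≤|A|) (base-realizesOn A 2≤|A|))
        suc-d⁺≤ : suc d⁺ ≤ ⌊ n /2⌋
        suc-d⁺≤ = m+3+⌊n/2⌋≤1+n⇒m<⌊n/2⌋ d⁺ n (begin
          d⁺ + (3 + ⌊ n /2⌋)                          ≡⟨ cong (λ ℓ → d⁺ + (2 + ℓ)) (sym (AntichainOf.length-elems A)) ⟩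
          d⁺ + length (s ∷ t ∷ AntichainOf.elems A)   ≤⟨ cost ⟩
          1 + length L⁺                               ≤⟨ s≤s (Unique⇒length≤ unique) ⟩
          suc n                                       ∎)
          where open ≤-Reasoning

  strictify : ∀ {k} → (Fin k → Fin n → ℕ) → Fin k → Fin n → ℕ
  strictify D g v = suc n * D g v + rank v

  strictify-realizes : ∀ {k} {D : Fin k → Fin n → ℕ} → Realizes k D → Realizes k (strictify D)
  strictify-realizes R u v = mk⇔
    (λ u≼v g → +-mono-≤ (*-monoʳ-≤ (suc n) (Equivalence.to (R u v) u≼v g)) (countBelow-mono _ u≼v))
    (λ below → Equivalence.from (R u v) λ g → lex-≤⇒≤ (suc n) (s≤s (countBelow≤n _ v)) (below g))

  strictify-strict : ∀ {k} {D : Fin k → Fin n → ℕ} → Realizes k D →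
    ∀ {u v} → T (u ≼ v) → u ≢ v → ∀ g → strictify D g u < strictify D g v
  strictify-strict R {u} {v} u≼v u≢v g =
    +-mono-≤-< (*-monoʳ-≤ (suc n) (Equivalence.to (R u v) u≼v g)) (rank-< u≼v u≢v)

module Lexicographic {n h k} (_≼_ : Fin n → Fin n → Bool) (_≼Q_ : Fin h → Fin h → Bool) (cls : Fin n → Fin h)
  (between : ∀ {u v} → cls u ≢ cls v → T (u ≼ v) ⇔ T (cls u ≼Q cls v))
  (DQ : Fin k → Fin h → ℕ)
  (DQ-strict : ∀ {i j} → T (i ≼Q j) → i ≢ j → ∀ g → DQ g i < DQ g j)
  (DQ-reflect : ∀ {i j} → (∀ g → DQ g i ≤ DQ g j) → T (i ≼Q j))
  {K} (DM : Fin h → Fin k → Fin n → ℕ) (DM<K : ∀ i g v → DM i g v < K)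
  (DM-realizes : ∀ i {u v} → cls u ≡ i → cls v ≡ i → T (u ≼ v) ⇔ (∀ g → DM i g u ≤ DM i g v)) where

  D : Fin k → Fin n → ℕ
  D g v = K * DQ g (cls v) + DM (cls v) g v

  realizes : ∀ u v → T (u ≼ v) ⇔ (∀ g → D g u ≤ D g v)
  realizes u v with cls u ≟ᶠ cls v
  ... | no ≢cls = mk⇔
    (λ u≼v g → <⇒≤ (lex-< K (DQ-strict (Equivalence.to (between ≢cls) u≼v) ≢cls g) (DM<K _ g u)))
    (λ below → Equivalence.from (between ≢cls) (DQ-reflect λ g → lex-≤⇒≤ K (DM<K _ g v) (below g)))
  ... | yes ≡cls = mk⇔
    (λ u≼v g → subst (_≤ D g v) (sym (D-u g)) (+-monoʳ-≤ (K * DQ g (cls v)) (Equivalence.to inClass u≼v g)))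
    (λ below → Equivalence.from inClass λ g →
      +-cancelˡ-≤ (K * DQ g (cls v)) _ _ (subst (_≤ D g v) (D-u g) (below g)))
    where
      inClass = DM-realizes (cls v) ≡cls refl
      D-u : ∀ g → D g u ≡ K * DQ g (cls v) + DM (cls v) g u
      D-u g = cong (λ i → K * DQ g i + DM i g u) ≡cls

Reach-trans : ∀ {g : Graph} {u v w} → Reach g u v → Reach g v w → Reach g u w
Reach-trans here         r′ = r′
Reach-trans (step e r) r′ = step e (Reach-trans r r′)

module DominanceOrder {n} (E : Fin n → Fin n → Set) (acyclic : Acyclic (finGraph n E))
                      {d} (D₀ : Fin d → Fin n → ℕ) (drawing : IsDominanceDrawing E d D₀) where

  G : Graph
  G = finGraph n E

  _≼_ : Fin n → Fin n → Bool
  u ≼ v = ⌊ all? (λ g → D₀ g u ≤? D₀ g v) ⌋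

  Reach⇒≼ : ∀ {u v} → Reach G u v → T (u ≼ v)
  Reach⇒≼ {u} {v} r = fromWitness (Equivalence.to (drawing u v) r)

  ≼⇒Reach : ∀ {u v} → T (u ≼ v) → Reach G u v
  ≼⇒Reach {u} {v} u≼v = Equivalence.from (drawing u v) (toWitness u≼v)

  ≼-refl : ∀ v → T (v ≼ v)
  ≼-refl _ = Reach⇒≼ here

  ≼-trans : ∀ {u v w} → T (u ≼ v) → T (v ≼ w) → T (u ≼ w)
  ≼-trans u≼v v≼w = Reach⇒≼ (Reach-trans (≼⇒Reach u≼v) (≼⇒Reach v≼w))

  ≼-antisym : ∀ {u v} → T (u ≼ v) → T (v ≼ u) → u ≡ v
  ≼-antisym u≼v v≼u = antisym (≼⇒Reach u≼v) (≼⇒Reach v≼u)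
    where
      antisym : ∀ {u v} → Reach G u v → Reach G v u → u ≡ v
      antisym here _ = refl
      antisym {u} (step {w = w} e r) r′ = contradiction (Reach-trans r r′) (acyclic u w e)

  open FinitePoset _≼_ ≼-refl ≼-trans ≼-antisym public

  Realizes⇒HasDominanceDrawing : ∀ {k D} → Realizes k D → HasDominanceDrawing E k
  Realizes⇒HasDominanceDrawing {D = D} R = D , λ u v →
    mk⇔ (Equivalence.to (R u v) ∘ Reach⇒≼) (≼⇒Reach ∘ Equivalence.from (R u v))

  minimal⇒source : ∀ {b} → (∀ {z} → T (z ≼ b) → z ≡ b) → IsSource G b
  minimal⇒source {b} b-min u e = acyclic b b (subst (λ z → E z b) (b-min (Reach⇒≼ (step e here))) e) here

  maximal⇒sink : ∀ {m} → (∀ {z} → T (m ≼ z) → z ≡ m) → IsSink G m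
  maximal⇒sink {m} m-max u e = acyclic m m (subst (E m) (m-max (Reach⇒≼ (step e here))) e) here

  module STGraph (st : IsSTGraph G) where
    s t : Fin n
    s = proj₁ (proj₂ st)
    t = proj₁ (proj₂ (proj₂ st))

    sources≡s : ∀ v → IsSource G v → v ≡ s
    sources≡s = proj₁ (proj₂ (proj₂ (proj₂ (proj₂ st))))

    sinks≡t : ∀ v → IsSink G v → v ≡ t
    sinks≡t = proj₁ (proj₂ (proj₂ (proj₂ (proj₂ (proj₂ (proj₂ st))))))

    s≢t : s ≢ t
    s≢t = proj₂ (proj₂ (proj₂ (proj₂ (proj₂ (proj₂ (proj₂ st))))))

    s-least : ∀ v → T (s ≼ v)
    s-least v = let b , _ , b≼v , b-min = minimalBelow (const true) {v} _
                in subst (λ z → T (z ≼ v)) (sources≡s b (minimal⇒source (b-min _))) b≼v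

    t-greatest : ∀ v → T (v ≼ t)
    t-greatest v = let m , v≼m , m-max = maximal (v ≼_) (Reach⇒≼ here)
                   in subst (λ z → T (v ≼ z))
                            (sinks≡t m (maximal⇒sink λ m≼z → m-max (≼-trans v≼m m≼z) m≼z)) v≼m

  module Congruence {h} (cls : Fin n → Fin h) (congruence : IsCongruencePartition E cls) where
    rep : Fin h → Fin n
    rep i = proj₁ (proj₁ (congruence i))

    cls-rep : ∀ i → cls (rep i) ≡ i
    cls-rep i = proj₂ (proj₁ (congruence i))

    rep-injective : ∀ {i j} → rep i ≡ rep j → i ≡ j
    rep-injective {i} {j} rep≡ = trans (sym (cls-rep i)) (trans (cong cls rep≡) (cls-rep j))

    ≼⇔Reach⁺ : ∀ {u v} → u ≢ v → T (u ≼ v) ⇔ Reach⁺ G u v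
    ≼⇔Reach⁺ u≢v = mk⇔ (toReach⁺ u≢v ∘ ≼⇒Reach) λ { (_ , e , r) → Reach⇒≼ (step e r) }
      where
        toReach⁺ : ∀ {u v} → u ≢ v → Reach G u v → Reach⁺ G u v
        toReach⁺ u≢u here       = contradiction refl u≢u
        toReach⁺ _   (step e r) = _ , e , r

    Reach⁺-from : ∀ {x y z} → cls x ≡ cls y → cls z ≢ cls x → Reach⁺ G x z ⇔ Reach⁺ G y z
    Reach⁺-from {x} {y} {z} x~y z≁x = proj₂ (proj₂ (congruence (cls x)) x y refl (sym x~y) z z≁x)

    Reach⁺-to : ∀ {x y z} → cls x ≡ cls y → cls z ≢ cls x → Reach⁺ G z x ⇔ Reach⁺ G z y
    Reach⁺-to {x} {y} {z} x~y z≁x = proj₁ (proj₂ (congruence (cls x)) x y refl (sym x~y) z z≁x)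

    _≼Q_ : Fin h → Fin h → Bool
    i ≼Q j = rep i ≼ rep j

    between : ∀ {u v} → cls u ≢ cls v → T (u ≼ v) ⇔ T (cls u ≼Q cls v)
    between {u} {v} u≁v = begin
      T (u ≼ v)                             ≈⟨ ≼⇔Reach⁺ (u≁v ∘ cong cls) ⟩
      Reach⁺ G u v                          ≈⟨ Reach⁺-from (sym (cls-rep (cls u))) (u≁v ∘ sym) ⟩
      Reach⁺ G (rep (cls u)) v              ≈⟨ Reach⁺-to (sym (cls-rep (cls v))) (u≁v ∘ trans (sym (cls-rep (cls u)))) ⟩
      Reach⁺ G (rep (cls u)) (rep (cls v))  ≈⟨ ≼⇔Reach⁺ (u≁v ∘ rep-injective) ⟨
      T (cls u ≼Q cls v)                    ∎
      where open SetoidReasoning (⇔-setoid 0ℓ)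

    ≼Q-antisym : ∀ {i j} → T (i ≼Q j) → T (j ≼Q i) → i ≡ j
    ≼Q-antisym i≼j j≼i = rep-injective (≼-antisym i≼j j≼i)

    module Q = FinitePoset _≼Q_ (≼-refl ∘ rep) ≼-trans ≼Q-antisym

    Reach₀⇒≼Q : ∀ {i j} → Reach (quotientGraph E cls) i j → T (i ≼Q j)
    Reach₀⇒≼Q here = ≼-refl _
    Reach₀⇒≼Q (step (i≢j , u , v , refl , refl , e) r) =
      ≼-trans (Equivalence.to (between i≢j) (Reach⇒≼ (step e here))) (Reach₀⇒≼Q r)

    Q-antichain⇒Antichain : ∀ {ℓ} (A : Q.AntichainOf (const true) ℓ) →
      Antichain (quotientGraph E cls) (Q.AntichainOf.elems A)
    Q-antichain⇒Antichain A = unique , λ i∈ j∈ i≢j → incomparable i∈ j∈ i≢j ∘ Reach₀⇒≼Q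
      where open Q.AntichainOf A

    inClass : Fin h → Fin n → Bool
    inClass i v = ⌊ cls v ≟ᶠ i ⌋

    module ModuleGraph (i : Fin h) (addS addT : Bool) where
      Gᵢ : Graph
      Gᵢ = moduleGraph E cls i addS addT

      real : ∀ {x} → cls x ≡ i → V Gᵢ
      real {x} x∈i = inj₂ (inj₁ (x , x∈i))

      Reachᵢ⇒Reach : ∀ {x y} {x∈i : cls x ≡ i} {y∈i : cls y ≡ i} →
        Reach Gᵢ (real x∈i) (real y∈i) → Reach G x y
      Reachᵢ⇒Reach here = here
      Reachᵢ⇒Reach (step {w = inj₂ (inj₁ _)} e r) = step e (Reachᵢ⇒Reach r)
      Reachᵢ⇒Reach (step {w = inj₂ (inj₂ _)} _ (step {w = inj₁ _} () _))
      Reachᵢ⇒Reach (step {w = inj₂ (inj₂ _)} _ (step {w = inj₂ _} () _))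

      embed : ∀ {xs} → All (λ x → cls x ≡ i) xs → List (V Gᵢ)
      embed []           = []
      embed (x∈i ∷ x∈is) = real x∈i ∷ embed x∈is

      length-embed : ∀ {xs} (x∈is : All (λ x → cls x ≡ i) xs) → length (embed x∈is) ≡ length xs
      length-embed []           = refl
      length-embed (_ ∷ x∈is) = cong suc (length-embed x∈is)

      ∈-embed⁻ : ∀ {xs y} (x∈is : All (λ x → cls x ≡ i) xs) → y ∈ embed x∈is →
        ∃ λ x → Σ[ x∈i ∈ cls x ≡ i ] x ∈ xs × y ≡ real x∈i
      ∈-embed⁻ (x∈i ∷ _)    (here refl) = _ , x∈i , here refl , refl
      ∈-embed⁻ (_ ∷ x∈is) (there y∈)  =
        let x , x∈i , x∈ , y≡ = ∈-embed⁻ x∈is y∈ in x , x∈i , there x∈ , y≡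

      real-≡ : ∀ {x y} (x∈i : cls x ≡ i) (y∈i : cls y ≡ i) → x ≡ y → real x∈i ≡ real y∈i
      real-≡ x∈i y∈i refl = cong real (Decidable⇒UIP.≡-irrelevant _≟ᶠ_ x∈i y∈i)

      embed-unique : ∀ {xs} (x∈is : All (λ x → cls x ≡ i) xs) → Unique xs → Unique (embed x∈is)
      embed-unique []           []              = []
      embed-unique (x∈i ∷ x∈is) (x∉xs ∷ unique) =
        All.tabulate (λ y∈ x≡y → let z , z∈i , z∈ , y≡ = ∈-embed⁻ x∈is y∈
                                 in All.lookup x∉xs z∈ (real-injective (trans x≡y y≡)))
        ∷ embed-unique x∈is unique
        where
          real-injective : ∀ {x y} {x∈i : cls x ≡ i} {y∈i : cls y ≡ i} → real x∈i ≡ real y∈i → x ≡ y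
          real-injective refl = refl

      antichain⇒Antichain : ∀ {ℓ} → AntichainOf (inClass i) ℓ → ∃ λ ys → Antichain Gᵢ ys × length ys ≡ ℓ
      antichain⇒Antichain A =
        embed x∈is , (embed-unique x∈is unique , incomparableᵢ) , trans (length-embed x∈is) length-elems
        where
          open AntichainOf A
          x∈is : All (λ x → cls x ≡ i) elems
          x∈is = All.tabulate (toWitness ∘ elems⊆S)
          incomparableᵢ : ∀ {y y′} → y ∈ embed x∈is → y′ ∈ embed x∈is → y ≢ y′ → ¬ Reach Gᵢ y y′
          incomparableᵢ y∈ y′∈ y≢y′ r with ∈-embed⁻ x∈is y∈ | ∈-embed⁻ x∈is y′∈
          ... | x , x∈i , x∈ , refl | x′ , x′∈i , x′∈ , refl =
            incomparable x∈ x′∈ (y≢y′ ∘ real-≡ x∈i x′∈i) (Reach⇒≼ (Reachᵢ⇒Reach r))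

    neckRealizer : ∀ {aug wN} → IsDimensionalNeck E cls aug wN → Σ[ D ∈ (Fin wN → Fin n → ℕ) ] Realizes wN D
    neckRealizer {aug} {wN} ((width₀ , widthᵢ) , _) = Lex.D , Lex.realizes
      where
        CQ : Q.ChainCover (const true) wN
        CQ with Q.dilworth (const true) wN
        ... | inj₁ C = C
        ... | inj₂ A = let _ , (_ , maximum) , w≤wN = width₀ in
          contradiction (subst (_≤ wN) (Q.AntichainOf.length-elems A)
                          (≤-trans (maximum _ (Q-antichain⇒Antichain A)) w≤wN)) 1+n≰n

        CM : ∀ i → ChainCover (inClass i) wN
        CM i with dilworth (inClass i) wN
        ... | inj₁ C = C
        ... | inj₂ A = let ys , antichain , length≡ = ModuleGraph.antichain⇒Antichain i _ _ A
                           _ , (_ , maximum) , w≤wN = widthᵢ i in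
          contradiction (subst (_≤ wN) length≡ (≤-trans (maximum ys antichain) w≤wN)) 1+n≰n

        RQ : Q.Realizes wN (Q.chainCount CQ)
        RQ = Q.chainCount-realizes CQ

        module Lex = Lexicographic _≼_ _≼Q_ cls between
          (Q.strictify (Q.chainCount CQ)) (Q.strictify-strict RQ)
          (λ {i} {j} → Equivalence.from (Q.strictify-realizes RQ i j))
          (chainCount ∘ CM) (λ i g v → s≤s (chainCount≤n (CM i) g v))
          (λ i u∈i v∈i → chainCount-realizesOn (CM i) (fromWitness u∈i) (fromWitness v∈i))

dominanceDimension≤⌊n/2⌋ : ∀ {n} {E : Fin n → Fin n → Set} {d} →
  IsSTGraph (finGraph n E) → IsDominanceDimension E d → d ≤ ⌊ n /2⌋
dominanceDimension≤⌊n/2⌋ {E = E} st ((D₀ , drawing) , least) =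
  let k , _ , R , k≤⌊n/2⌋ = Bounded.dimension≤⌊n/2⌋ s-least t-greatest s≢t
  in ≤-trans (least k (Realizes⇒HasDominanceDrawing R)) k≤⌊n/2⌋
  where
    open DominanceOrder E (proj₁ st) D₀ drawing
    open STGraph st

dominanceDimension≤neck : ∀ {n h} {E : Fin n → Fin n → Set} {cls : Fin n → Fin h} {aug wN d} →
  Acyclic (finGraph n E) → IsCongruencePartition E cls → IsDimensionalNeck E cls aug wN →
  IsDominanceDimension E d → d ≤ wN
dominanceDimension≤neck {E = E} {cls} {wN = wN} acyclic congruence neck ((D₀ , drawing) , least) =
  least wN (Realizes⇒HasDominanceDrawing (proj₂ (neckRealizer neck)))
  where
    open DominanceOrder E acyclic D₀ drawing
    open Congruence cls congruence

corollary4 : (n : ℕ) (E : Fin n → Fin n → Set) →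
    IsSTGraph (finGraph n E) →
    (h : ℕ) (cls : Fin n → Fin h) → IsCongruencePartition E cls →
    (aug : Fin h → Bool × Bool) →
    (∀ i → IsSTGraph (moduleGraph E cls i (proj₁ (aug i)) (proj₂ (aug i)))) →
    (wN : ℕ) → IsDimensionalNeck E cls aug wN →
    (d : ℕ) → IsDominanceDimension E d →
    (2 * d ≤ n) × (d ≤ wN)
-- The module graphs need not be st-graphs: only their widths enter, through w_N.
corollary4 n E st h cls congruence aug _ wN neck d dimension =
  ≤⌊n/2⌋⇒2*≤ (dominanceDimension≤⌊n/2⌋ st dimension) ,
  dominanceDimension≤neck (proj₁ st) congruence neck dimension
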